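{- Let $G$ and $H$ be threshold graphs. Then $G$ is (isomorphic to) an induced subgraph of $H$ if and only if $\mathrm{seq}(G)$ is a (not necessarily contiguous) subsequence of $\mathrm{seq}(H)$.
   Context: Every threshold graph on $n\ge 1$ vertices is obtained from a single vertex (the base vertex, of index $0$) by adding vertices $v_1,\dots,v_{n-1}$ one at a time, each either as an isolated vertex or as a dominating vertex (adjacent to all previously present vertices). The creation sequence $\mathrm{seq}(G)=s_1s_2\dots s_{n-1}\in\{0,1\}^{n-1}$ records $s_i=1$ if $v_i$ (the vertex of index $i$) was added as a dominating vertex and $s_i=0$ if it was added as an isolated vertex; it determines the unlabeled graph. Thus for $0\le i<j$, the vertices of index $i$ and $j$ are adjacent iff $s_j=1$. -}

module Defs where

open import Data.Bool using (Bool; true; false; not; _∧_)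
open import Data.Nat using (ℕ; zero; suc; _⊔_; _≡ᵇ_)
open import Data.Nat.Properties using (⊔-comm)
open import Data.Fin using (Fin; toℕ)
open import Data.List using (List; []; _∷_; length)
open import Function.Bundles using (_↔_; _↣_; Inverse; Injection)
open import Relation.Binary.PropositionalEquality using (_≡_; refl; cong₂)

record Graph (n : ℕ) : Set where
  field
    adj    : Fin n → Fin n → Bool
    sym    : ∀ i j → adj i j ≡ adj j i
    irrefl : ∀ i → adj i i ≡ false
open Graph public

record _≅_ {m n : ℕ} (G : Graph m) (H : Graph n) : Set where
  field
    bij      : Fin m ↔ Fin n
    preserve : ∀ i j → adj G i j ≡ adj H (Inverse.to bij i) (Inverse.to bij j)

record _⊑ind_ {m n : ℕ} (G : Graph m) (H : Graph n) : Set where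
  field
    emb      : Fin m ↣ Fin n
    preserve : ∀ i j → adj G i j ≡ adj H (Injection.to emb i) (Injection.to emb j)

-- Bit of the creation sequence s = s₁ … s_{n-1} at index k (index 0 = base vertex, no bit).
bitAt : List Bool → ℕ → Bool
bitAt s       zero          = false
bitAt []      (suc k)       = false
bitAt (b ∷ s) (suc zero)    = b
bitAt (b ∷ s) (suc (suc k)) = bitAt s (suc k)

private
  ≡ᵇ-sym : ∀ a b → (a ≡ᵇ b) ≡ (b ≡ᵇ a)
  ≡ᵇ-sym zero zero = refl
  ≡ᵇ-sym zero (suc b) = refl
  ≡ᵇ-sym (suc a) zero = refl
  ≡ᵇ-sym (suc a) (suc b) = ≡ᵇ-sym a b

  ≡ᵇ-refl : ∀ a → (a ≡ᵇ a) ≡ true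
  ≡ᵇ-refl zero = refl
  ≡ᵇ-refl (suc a) = ≡ᵇ-refl a

-- Adjacency in the threshold graph with creation sequence s:
-- vertices of index i < j are adjacent iff s_j = 1, i.e. iff the bit at max(i,j) is 1.
thrAdj : (s : List Bool) → Fin (suc (length s)) → Fin (suc (length s)) → Bool
thrAdj s i j = not (toℕ i ≡ᵇ toℕ j) ∧ bitAt s (toℕ i ⊔ toℕ j)

thr : (s : List Bool) → Graph (suc (length s))
thr s = record
  { adj    = thrAdj s
  ; sym    = λ i j → cong₂ (λ x y → not x ∧ bitAt s y) (≡ᵇ-sym (toℕ i) (toℕ j)) (⊔-comm (toℕ i) (toℕ j))
  ; irrefl = irr
  }
  where
  irr : ∀ i → thrAdj s i i ≡ false
  irr i rewrite ≡ᵇ-refl (toℕ i) = refl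

IsSeqOf : {n : ℕ} → List Bool → Graph n → Set
IsSeqOf s G = G ≅ thr s

-- In thr s the vertices i < j are adjacent iff bit j is set, so a strictly increasing
-- vertex map that preserves the bits is an induced embedding; a subsequence s ⊆ t
-- yields one by sending each position of s to the position of t it is taken from.
-- Conversely, induct on t from its end. The last vertex of thr t is dominating or
-- isolated according to its bit c. If it is not in the image of an embedding of thr s,
-- it can be deleted. Otherwise its preimage v is adjacent to all or to none of the other
-- vertices of thr s, which forces every bit of s from v on to be c; in particular the
-- last bit of s is c, and deleting v from thr s leaves a copy of thr (init s) inside
-- thr (init t).
module Submission where

open import Defs hiding (sym)
open import Data.Bool using (Bool; false; not; _∧_)
open import Data.Bool.Properties using (¬-not; T-≡)
open import Data.Nat using (ℕ; zero; suc; pred; _⊔_; _≡ᵇ_; _≟_; _≤_; _<_; z≤n; s≤s; s≤s⁻¹)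
open import Data.Nat.Properties
  using ( ≡ᵇ⇒≡; ≡⇒≡ᵇ; <-cmp; <-≤-connex; <⇒≢; >⇒≢; <⇒≤; ≤∧≢⇒<; ≤-refl; ≤-trans
        ; m≤n⇒m≤1+n; m≤n⇒m<n∨m≡n; n≤0⇒n≡0; m≤n⇒m⊔n≡n; m≥n⇒m⊔n≡m; ⊔-lub; +-comm )
open import Data.Nat.DivMod using (_mod_; m≤n⇒m%n≡m)
open import Data.Fin using (Fin; toℕ; fromℕ<)
open import Data.Fin.Properties using (toℕ-injective; toℕ≤pred[n]; toℕ-fromℕ<; any?)
open import Data.List using (List; []; _∷_; [_]; length; _∷ʳ_)
open import Data.List.Properties using (length-++)
open import Data.List.Reverse using (Reverse; []; _∶_∶ʳ_; reverseView)
open import Data.List.Relation.Binary.Sublist.Propositional using (_⊆_; []; _∷_; ⊆-refl; minimum)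
  renaming (_∷ʳ_ to skip)
open import Data.List.Relation.Binary.Sublist.Propositional.Properties using (++⁺; ++⁺ʳ)
open import Data.Product using (_×_; _,_)
open import Data.Sum using (inj₁; inj₂)
open import Function.Base using (_∘_)
open import Function.Bundles using (Inverse; Injection; Equivalence; mk↣)
open import Function.Construct.Composition using (_↣-∘_)
open import Function.Properties.Inverse using (↔⇒↣; ↔-sym)
open import Relation.Binary using (tri<; tri≈; tri>)
open import Relation.Binary.PropositionalEquality
  using (_≡_; _≢_; refl; sym; trans; cong; cong₂; subst; module ≡-Reasoning)
open import Relation.Nullary using (yes; no; contradiction)

open ≡-Reasoning

private
  variable
    m n k : ℕ
    i j v : ℕ
    b c : Bool
    s t w : List Bool

⊑ind-trans : {G : Graph m} {H : Graph n} {K : Graph k} → G ⊑ind H → H ⊑ind K → G ⊑ind K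
⊑ind-trans ι κ = record
  { emb      = _⊑ind_.emb κ ↣-∘ _⊑ind_.emb ι
  ; preserve = λ x y → trans (_⊑ind_.preserve ι x y) (_⊑ind_.preserve κ _ _)
  }

≅⇒⊑ind : {G : Graph m} {H : Graph n} → G ≅ H → G ⊑ind H
≅⇒⊑ind φ = record { emb = ↔⇒↣ (_≅_.bij φ) ; preserve = _≅_.preserve φ }

≅⇒⊒ind : {G : Graph m} {H : Graph n} → G ≅ H → H ⊑ind G
≅⇒⊒ind {G = G} {H = H} φ = record { emb = ↔⇒↣ (↔-sym bij) ; preserve = reflects }
  where
  open _≅_ φ using (bij)
  open Inverse bij using (from; strictlyInverseˡ)

  reflects : ∀ x y → adj H x y ≡ adj G (from x) (from y)
  reflects x y = sym (trans (_≅_.preserve φ (from x) (from y))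
                            (cong₂ (adj H) (strictlyInverseˡ x) (strictlyInverseˡ y)))

thrAdjℕ : List Bool → ℕ → ℕ → Bool
thrAdjℕ s i j = not (i ≡ᵇ j) ∧ bitAt s (i ⊔ j)

thrAdjℕ-irrefl : ∀ s i → thrAdjℕ s i i ≡ false
thrAdjℕ-irrefl s i =
  cong (λ e → not e ∧ bitAt s (i ⊔ i)) (Equivalence.to T-≡ (≡⇒≡ᵇ i i refl))

thrAdjℕ-≢ : i ≢ j → thrAdjℕ s i j ≡ bitAt s (i ⊔ j)
thrAdjℕ-≢ {i} {j} {s} i≢j =
  cong (λ e → not e ∧ bitAt s (i ⊔ j)) (¬-not (λ eq → i≢j (≡ᵇ⇒≡ i j (Equivalence.from T-≡ eq))))

thrAdjℕ-< : i < j → thrAdjℕ s i j ≡ bitAt s j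
thrAdjℕ-< {s = s} i<j = trans (thrAdjℕ-≢ (<⇒≢ i<j)) (cong (bitAt s) (m≤n⇒m⊔n≡n (<⇒≤ i<j)))

thrAdjℕ-> : j < i → thrAdjℕ s i j ≡ bitAt s i
thrAdjℕ-> {s = s} j<i = trans (thrAdjℕ-≢ (>⇒≢ j<i)) (cong (bitAt s) (m≥n⇒m⊔n≡m (<⇒≤ j<i)))

length-∷ʳ : ∀ (s : List Bool) b → length (s ∷ʳ b) ≡ suc (length s)
length-∷ʳ s b = trans (length-++ s) (+-comm (length s) 1)

≤-length-∷ʳ : ∀ s b → j ≤ suc (length s) → j ≤ length (s ∷ʳ b)
≤-length-∷ʳ {j} s b = subst (j ≤_) (sym (length-∷ʳ s b))

bitAt-∷ʳ : j ≤ length s → bitAt (s ∷ʳ b) j ≡ bitAt s j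
bitAt-∷ʳ {zero}                _        = refl
bitAt-∷ʳ {suc zero}    {_ ∷ s} _        = refl
bitAt-∷ʳ {suc (suc j)} {_ ∷ s} (s≤s j≤) = bitAt-∷ʳ {s = s} j≤

bitAt-∷ʳ-last : ∀ s b → bitAt (s ∷ʳ b) (suc (length s)) ≡ b
bitAt-∷ʳ-last []          b = refl
bitAt-∷ʳ-last (_ ∷ [])    b = refl
bitAt-∷ʳ-last (_ ∷ x ∷ s) b = bitAt-∷ʳ-last (x ∷ s) b

thrAdjℕ-∷ʳ : i ≤ length s → j ≤ length s → thrAdjℕ (s ∷ʳ b) i j ≡ thrAdjℕ s i j
thrAdjℕ-∷ʳ {i} {s} {j} i≤ j≤ = cong (not (i ≡ᵇ j) ∧_) (bitAt-∷ʳ {s = s} (⊔-lub i≤ j≤))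

thrAdjℕ-∷ʳ-last : i ≤ length s → thrAdjℕ (s ∷ʳ b) (suc (length s)) i ≡ b
thrAdjℕ-∷ʳ-last {s = s} {b} i≤ = trans (thrAdjℕ-> (s≤s i≤)) (bitAt-∷ʳ-last s b)

-- Indexed by ℕ rather than by Fin so that splitting off the last bit of s or t
-- needs no casts along length (s ∷ʳ b) ≡ suc (length s).
record ThrEmbedding (s t : List Bool) : Set where
  field
    map       : ℕ → ℕ
    bounded   : i ≤ length s → map i ≤ length t
    injective : i ≤ length s → j ≤ length s → map i ≡ map j → i ≡ j
    preserves : i ≤ length s → j ≤ length s → thrAdjℕ s i j ≡ thrAdjℕ t (map i) (map j)
open ThrEmbedding

⊑ind⇒ThrEmbedding : thr s ⊑ind thr t → ThrEmbedding s t
⊑ind⇒ThrEmbedding {s} {t} ι = record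
  { map       = λ i → toℕ (to (vertex i))
  ; bounded   = λ _ → toℕ≤pred[n] _
  ; injective = λ i≤ j≤ eq → trans (sym (toℕ-vertex i≤))
                  (trans (cong toℕ (Injection.injective emb (toℕ-injective eq))) (toℕ-vertex j≤))
  ; preserves = λ i≤ j≤ → trans (cong₂ (thrAdjℕ s) (sym (toℕ-vertex i≤)) (sym (toℕ-vertex j≤)))
                                (preserve _ _)
  }
  where
  open _⊑ind_ ι
  open Injection emb using (to)

  vertex : ℕ → Fin (suc (length s))
  vertex i = i mod suc (length s)

  toℕ-vertex : i ≤ length s → toℕ (vertex i) ≡ i
  toℕ-vertex i≤ = trans (toℕ-fromℕ< _) (m≤n⇒m%n≡m i≤)

ThrEmbedding⇒⊑ind : ThrEmbedding s t → thr s ⊑ind thr t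
ThrEmbedding⇒⊑ind {s} {t} e = record
  { emb      = mk↣ injective′
  ; preserve = λ x y → trans (preserves e (toℕ≤pred[n] x) (toℕ≤pred[n] y))
                             (sym (cong₂ (thrAdjℕ t) (toℕ-vertex x) (toℕ-vertex y)))
  }
  where
  vertex : Fin (suc (length s)) → Fin (suc (length t))
  vertex x = fromℕ< (s≤s (bounded e (toℕ≤pred[n] x)))

  toℕ-vertex : ∀ x → toℕ (vertex x) ≡ map e (toℕ x)
  toℕ-vertex x = toℕ-fromℕ< (s≤s (bounded e (toℕ≤pred[n] x)))

  injective′ : ∀ {x y} → vertex x ≡ vertex y → x ≡ y
  injective′ {x} {y} eq = toℕ-injective (injective e (toℕ≤pred[n] x) (toℕ≤pred[n] y)
    (trans (sym (toℕ-vertex x)) (trans (cong toℕ eq) (toℕ-vertex y))))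

ThrEmbedding-trans : ThrEmbedding s t → ThrEmbedding t w → ThrEmbedding s w
ThrEmbedding-trans e f = record
  { map       = λ i → map f (map e i)
  ; bounded   = λ i≤ → bounded f (bounded e i≤)
  ; injective = λ i≤ j≤ → injective e i≤ j≤ ∘ injective f (bounded e i≤) (bounded e j≤)
  ; preserves = λ i≤ j≤ → trans (preserves e i≤ j≤) (preserves f (bounded e i≤) (bounded e j≤))
  }

increasing⇒ThrEmbedding : (f : ℕ → ℕ) →
  (∀ {i j} → i < j → f i < f j) →
  (∀ {j} → j ≤ length s → f j ≤ length t) →
  (∀ {j} → 0 < j → j ≤ length s → bitAt t (f j) ≡ bitAt s j) →
  ThrEmbedding s t
increasing⇒ThrEmbedding {s} {t} f increasing bounded bits = record
  { map = f ; bounded = bounded ; injective = λ _ _ → injective′ ; preserves = preserves′ }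
  where
  injective′ : f i ≡ f j → i ≡ j
  injective′ {i} {j} eq with <-cmp i j
  ... | tri< i<j _ _ = contradiction eq (<⇒≢ (increasing i<j))
  ... | tri≈ _ i≡j _ = i≡j
  ... | tri> _ _ j<i = contradiction eq (>⇒≢ (increasing j<i))

  preserves′ : i ≤ length s → j ≤ length s → thrAdjℕ s i j ≡ thrAdjℕ t (f i) (f j)
  preserves′ {i} {j} i≤ j≤ with <-cmp i j
  ... | tri< i<j _ _ = begin
    thrAdjℕ s i j         ≡⟨ thrAdjℕ-< i<j ⟩
    bitAt s j             ≡⟨ bits (≤-trans (s≤s z≤n) i<j) j≤ ⟨
    bitAt t (f j)         ≡⟨ thrAdjℕ-< (increasing i<j) ⟨
    thrAdjℕ t (f i) (f j) ∎
  ... | tri≈ _ refl _ = trans (thrAdjℕ-irrefl s i) (sym (thrAdjℕ-irrefl t (f i)))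
  ... | tri> _ _ j<i = begin
    thrAdjℕ s i j         ≡⟨ thrAdjℕ-> j<i ⟩
    bitAt s i             ≡⟨ bits (≤-trans (s≤s z≤n) j<i) i≤ ⟨
    bitAt t (f i)         ≡⟨ thrAdjℕ-> (increasing j<i) ⟨
    thrAdjℕ t (f i) (f j) ∎

-- Subsequences give embeddings

positionMap : s ⊆ t → ℕ → ℕ
positionMap []         k       = k
positionMap (skip _ p) k       = suc (positionMap p k)
positionMap (_ ∷ p)    zero    = zero
positionMap (_ ∷ p)    (suc k) = suc (positionMap p k)

positionMap-increasing : (p : s ⊆ t) → i < j → positionMap p i < positionMap p j
positionMap-increasing []         i<j = i<j
positionMap-increasing (skip _ p) i<j = s≤s (positionMap-increasing p i<j)
positionMap-increasing {i = zero}  {suc j} (_ ∷ p) _ = s≤s z≤n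
positionMap-increasing {i = suc i} {suc j} (_ ∷ p) (s≤s i<j) = s≤s (positionMap-increasing p i<j)

positionMap-bounded : (p : s ⊆ t) → k < length s → positionMap p k < length t
positionMap-bounded (skip _ p) k< = s≤s (positionMap-bounded p k<)
positionMap-bounded {k = zero}  (_ ∷ p) _ = s≤s z≤n
positionMap-bounded {k = suc k} (_ ∷ p) (s≤s k<) = s≤s (positionMap-bounded p k<)

bitAt-positionMap : (p : s ⊆ t) → ∀ k → bitAt t (suc (positionMap p k)) ≡ bitAt s (suc k)
bitAt-positionMap []         k       = refl
bitAt-positionMap (skip _ p) k       = bitAt-positionMap p k
bitAt-positionMap (refl ∷ p) zero    = refl
bitAt-positionMap (refl ∷ p) (suc k) = bitAt-positionMap p k

⊆⇒ThrEmbedding : s ⊆ t → ThrEmbedding s t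
⊆⇒ThrEmbedding {s} {t} p =
  increasing⇒ThrEmbedding vertexMap vertexMap-increasing vertexMap-bounded bitAt-vertexMap
  where
  vertexMap : ℕ → ℕ
  vertexMap zero    = zero
  vertexMap (suc k) = suc (positionMap p k)

  vertexMap-increasing : i < j → vertexMap i < vertexMap j
  vertexMap-increasing {zero}  {suc j} _         = s≤s z≤n
  vertexMap-increasing {suc i} {suc j} (s≤s i<j) = s≤s (positionMap-increasing p i<j)

  vertexMap-bounded : j ≤ length s → vertexMap j ≤ length t
  vertexMap-bounded {zero}  _  = z≤n
  vertexMap-bounded {suc k} k< = positionMap-bounded p k<

  bitAt-vertexMap : 0 < j → j ≤ length s → bitAt t (vertexMap j) ≡ bitAt s j
  bitAt-vertexMap {suc k} _ _ = bitAt-positionMap p k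

⊆⇒thr-⊑ind : s ⊆ t → thr s ⊑ind thr t
⊆⇒thr-⊑ind p = ThrEmbedding⇒⊑ind (⊆⇒ThrEmbedding p)

-- Embeddings give subsequences

ConstantFrom : List Bool → ℕ → Bool → Set
ConstantFrom s v c = ∀ {j} → v ≤ j → 0 < j → j ≤ length s → bitAt s j ≡ c

uniform⇒ConstantFrom : (∀ {u} → u ≤ length s → u ≢ v → thrAdjℕ s v u ≡ c) → ConstantFrom s v c
uniform⇒ConstantFrom {s} {v} {c} uniform {j} v≤j 0<j j≤ with m≤n⇒m<n∨m≡n v≤j
... | inj₁ v<j  = trans (sym (thrAdjℕ-< v<j)) (uniform j≤ (>⇒≢ v<j))
... | inj₂ refl = trans (sym (thrAdjℕ-> 0<j)) (uniform z≤n (<⇒≢ 0<j))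

skipAt : ℕ → ℕ → ℕ
skipAt zero    j       = suc j
skipAt (suc v) zero    = zero
skipAt (suc v) (suc j) = suc (skipAt v j)

skipAt-increasing : ∀ v {i j} → i < j → skipAt v i < skipAt v j
skipAt-increasing zero    i<j                     = s≤s i<j
skipAt-increasing (suc v) {zero}  {suc j} _         = s≤s z≤n
skipAt-increasing (suc v) {suc i} {suc j} (s≤s i<j) = s≤s (skipAt-increasing v i<j)

skipAt-< : j < v → skipAt v j ≡ j
skipAt-< {zero}  {suc v} _         = refl
skipAt-< {suc j} {suc v} (s≤s j<v) = cong suc (skipAt-< j<v)

skipAt-≥ : v ≤ j → skipAt v j ≡ suc j
skipAt-≥ {zero}          _         = refl
skipAt-≥ {suc v} {suc j} (s≤s v≤j) = cong suc (skipAt-≥ v≤j)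

skipAt-≢ : ∀ v j → skipAt v j ≢ v
skipAt-≢ (suc v) (suc j) eq = skipAt-≢ v j (cong pred eq)

skipAt-≤ : ∀ v j → skipAt v j ≤ suc j
skipAt-≤ zero    j       = ≤-refl
skipAt-≤ (suc v) zero    = z≤n
skipAt-≤ (suc v) (suc j) = s≤s (skipAt-≤ v j)

-- Deleting v from thr (s ∷ʳ b) and renumbering the remaining vertices in order
-- gives back thr s: the bits moved down by one index are all equal to c.
skipThrEmbedding : ConstantFrom (s ∷ʳ b) v c → ThrEmbedding s (s ∷ʳ b)
skipThrEmbedding {s} {b} {v} {c} constant =
  increasing⇒ThrEmbedding (skipAt v) (skipAt-increasing v) skipAt-bounded bitAt-skipAt
  where
  skipAt-bounded : j ≤ length s → skipAt v j ≤ length (s ∷ʳ b)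
  skipAt-bounded {j} j≤ = ≤-length-∷ʳ s b (≤-trans (skipAt-≤ v j) (s≤s j≤))

  bitAt-skipAt : 0 < j → j ≤ length s → bitAt (s ∷ʳ b) (skipAt v j) ≡ bitAt s j
  bitAt-skipAt {j} 0<j j≤ with <-≤-connex j v
  ... | inj₁ j<v = trans (cong (bitAt (s ∷ʳ b)) (skipAt-< j<v)) (bitAt-∷ʳ {s = s} j≤)
  ... | inj₂ v≤j = begin
    bitAt (s ∷ʳ b) (skipAt v j) ≡⟨ cong (bitAt (s ∷ʳ b)) (skipAt-≥ v≤j) ⟩
    bitAt (s ∷ʳ b) (suc j)      ≡⟨ constant (m≤n⇒m≤1+n v≤j) (s≤s z≤n) (≤-length-∷ʳ s b (s≤s j≤)) ⟩
    c                           ≡⟨ constant v≤j 0<j (≤-length-∷ʳ s b (m≤n⇒m≤1+n j≤)) ⟨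
    bitAt (s ∷ʳ b) j            ≡⟨ bitAt-∷ʳ {s = s} j≤ ⟩
    bitAt s j                   ∎

module _ (e : ThrEmbedding s (t ∷ʳ c)) where

  missesLast⇒bounded : i ≤ length s → map e i ≢ suc (length t) → map e i ≤ length t
  missesLast⇒bounded {i} i≤ ≢last =
    s≤s⁻¹ (≤∧≢⇒< (subst (map e i ≤_) (length-∷ʳ t c) (bounded e i≤)) ≢last)

  dropLast : (∀ {i} → i ≤ length s → map e i ≢ suc (length t)) → ThrEmbedding s t
  dropLast missesLast = record
    { map       = map e
    ; bounded   = below
    ; injective = injective e
    ; preserves = λ i≤ j≤ → trans (preserves e i≤ j≤) (thrAdjℕ-∷ʳ (below i≤) (below j≤))
    }
    where
    below : i ≤ length s → map e i ≤ length t
    below i≤ = missesLast⇒bounded i≤ (missesLast i≤)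

  hitsLast⇒uniform : v ≤ length s → map e v ≡ suc (length t) →
    ∀ {u} → u ≤ length s → u ≢ v → thrAdjℕ s v u ≡ c
  hitsLast⇒uniform {v} v≤ hit {u} u≤ u≢v = begin
    thrAdjℕ s v u                               ≡⟨ preserves e v≤ u≤ ⟩
    thrAdjℕ (t ∷ʳ c) (map e v) (map e u)        ≡⟨ cong (λ x → thrAdjℕ (t ∷ʳ c) x (map e u)) hit ⟩
    thrAdjℕ (t ∷ʳ c) (suc (length t)) (map e u) ≡⟨ thrAdjℕ-∷ʳ-last (missesLast⇒bounded u≤ u≢last) ⟩
    c                                           ∎
    where
    u≢last : map e u ≢ suc (length t)
    u≢last hitᵤ = u≢v (injective e u≤ v≤ (trans hitᵤ (sym hit)))

peelLast : (e : ThrEmbedding (s ∷ʳ b) (t ∷ʳ c)) → v ≤ length (s ∷ʳ b) →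
  map e v ≡ suc (length t) → b ≡ c × ThrEmbedding s t
peelLast {s} {b} {t} {c} {v} e v≤ hit =
  lastBit , dropLast (ThrEmbedding-trans deleteV e) skipMissesLast
  where
  constant : ConstantFrom (s ∷ʳ b) v c
  constant = uniform⇒ConstantFrom (hitsLast⇒uniform e v≤ hit)

  lastBit : b ≡ c
  lastBit = trans (sym (bitAt-∷ʳ-last s b))
    (constant (subst (v ≤_) (length-∷ʳ s b) v≤) (s≤s z≤n) (≤-length-∷ʳ s b ≤-refl))

  deleteV : ThrEmbedding s (s ∷ʳ b)
  deleteV = skipThrEmbedding constant

  skipMissesLast : i ≤ length s → map e (skipAt v i) ≢ suc (length t)
  skipMissesLast {i} i≤ hitᵢ =
    skipAt-≢ v i (injective e (bounded deleteV i≤) v≤ (trans hitᵢ (sym hit)))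

ThrEmbedding⇒⊆ : Reverse t → ThrEmbedding s t → s ⊆ t
ThrEmbedding⇒⊆ {s = []}    []  e = []
ThrEmbedding⇒⊆ {s = _ ∷ _} []  e =
  contradiction (injective e z≤n (s≤s z≤n) base≡1) λ ()
  where
  base≡1 : map e 0 ≡ map e 1
  base≡1 = trans (n≤0⇒n≡0 (bounded e z≤n)) (sym (n≤0⇒n≡0 (bounded e (s≤s z≤n))))
ThrEmbedding⇒⊆ {s = s} (t ∶ rt ∶ʳ c) e
  with any? (λ x → map e (toℕ x) ≟ suc (length t))
... | no missesLast = ++⁺ʳ [ c ] (ThrEmbedding⇒⊆ rt (dropLast e missed))
  where
  missed : i ≤ length s → map e i ≢ suc (length t)
  missed i≤ hit = missesLast (fromℕ< (s≤s i≤) , trans (cong (map e) (toℕ-fromℕ< _)) hit)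
... | yes (x , hit) with reverseView s
...   | [] = minimum _
...   | s′ ∶ _ ∶ʳ b with peelLast e (toℕ≤pred[n] x) hit
...     | refl , e′ = ++⁺ (ThrEmbedding⇒⊆ rt e′) ⊆-refl

thr-⊑ind⇒⊆ : thr s ⊑ind thr t → s ⊆ t
thr-⊑ind⇒⊆ ι = ThrEmbedding⇒⊆ (reverseView _) (⊑ind⇒ThrEmbedding ι)

mainTheorem1 : ∀ {m n : ℕ} (G : Graph m) (H : Graph n) (s t : List Bool) →
    IsSeqOf s G → IsSeqOf t H →
    ((G ⊑ind H → s ⊆ t) × (s ⊆ t → G ⊑ind H))
mainTheorem1 G H s t φ ψ =
    (λ G⊑H → thr-⊑ind⇒⊆ (⊑ind-trans (≅⇒⊒ind φ) (⊑ind-trans G⊑H (≅⇒⊑ind ψ))))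
  , (λ s⊆t → ⊑ind-trans (≅⇒⊑ind φ) (⊑ind-trans (⊆⇒thr-⊑ind s⊆t) (≅⇒⊒ind ψ)))
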